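{- Let $\mathbb T,\mathbb S$ be guarded monads on a category with finite coproducts, let $\rho\colon\mathbb T\to\mathbb S$ be a guarded retraction witnessed by $(\upsilon_X\colon SX\to TX)_X$, and suppose $\mathbb T$ is guarded pre-iterative with iteration operator $(-)^\dagger$. Then $\mathbb S$ is guarded pre-iterative with the iteration operator $f\mapsto f^{\ddagger}=\rho_Y\circ(\upsilon_{Y+X}\circ f)^\dagger$ for $f\colon X\to_{\mathrm{inr}}S(Y+X)$.
   Context: Monads have unit $\eta$ and Kleisli lifting $(-)^*$. A summand $\sigma$ of $Y$ is a pair of morphisms exhibiting $Y$ as a coproduct. A guarded monad $\mathbb T$ has a relation $f\colon X\to_\sigma TY$ closed under (trv) $T(\mathrm{inl})\circ f\colon X\to_{\mathrm{inr}}T(Y+Z)$ for all $f\colon X\to TY$; (par) $f\colon X\to_\sigma TZ$, $g\colon Y\to_\sigma TZ$ imply $[f,g]\colon X+Y\to_\sigma TZ$; (cmp) $f\colon X\to_{\mathrm{inr}}T(Y+Z)$, $g\colon Y\to_\sigma TV$, $h\colon Z\to TV$ imply $[g,h]^*\circ f\colon X\to_\sigma TV$. It is guarded pre-iterative if equipped with an operator assigning to each $f\colon X\to_{\mathrm{inr}}T(Y+X)$ some $f^\dagger\colon X\to TY$ with $f^\dagger=[\eta,f^\dagger]^*\circ f$. A monad morphism $\rho\colon\mathbb T\to\mathbb S$ is a guarded retraction if there is a family $(\upsilon_X\colon SX\to TX)_X$ (not necessarily natural) with $\rho_X\circ\upsilon_X=\mathrm{id}$ and such that $f\colon X\to_\sigma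 SY$ implies $\upsilon_Y\circ f\colon X\to_\sigma TY$. -}

module Defs where

open import Level using (Level; _⊔_) renaming (suc to lsuc)
open import Relation.Binary using (Rel; IsEquivalence)

record Category (o ℓ e : Level) : Set (lsuc (o ⊔ ℓ ⊔ e)) where
  infixr 9 _∘_
  infix 4 _≈_
  infixr 5 _⇒_
  field
    Obj : Set o
    _⇒_ : Obj → Obj → Set ℓ
    _≈_ : ∀ {A B} → Rel (A ⇒ B) e
    id : ∀ {A} → A ⇒ A
    _∘_ : ∀ {A B C} → B ⇒ C → A ⇒ B → A ⇒ C
    assoc : ∀ {A B C D} {f : A ⇒ B} {g : B ⇒ C} {h : C ⇒ D} →
            (h ∘ g) ∘ f ≈ h ∘ (g ∘ f)
    identityˡ : ∀ {A B} {f : A ⇒ B} → id ∘ f ≈ f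
    identityʳ : ∀ {A B} {f : A ⇒ B} → f ∘ id ≈ f
    equiv : ∀ {A B} → IsEquivalence (_≈_ {A} {B})
    ∘-resp-≈ : ∀ {A B C} {f h : B ⇒ C} {g i : A ⇒ B} →
               f ≈ h → g ≈ i → f ∘ g ≈ h ∘ i

module _ {o ℓ e : Level} (C : Category o ℓ e) where
  open Category C

  record IsCoproduct {A B Y : Obj} (i₁ : A ⇒ Y) (i₂ : B ⇒ Y) : Set (o ⊔ ℓ ⊔ e) where
    field
      copair : ∀ {Z} → A ⇒ Z → B ⇒ Z → Y ⇒ Z
      inject₁ : ∀ {Z} {f : A ⇒ Z} {g : B ⇒ Z} → copair f g ∘ i₁ ≈ f
      inject₂ : ∀ {Z} {f : A ⇒ Z} {g : B ⇒ Z} → copair f g ∘ i₂ ≈ g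
      unique : ∀ {Z} {f : A ⇒ Z} {g : B ⇒ Z} {h : Y ⇒ Z} →
               h ∘ i₁ ≈ f → h ∘ i₂ ≈ g → h ≈ copair f g

  record FiniteCoproducts : Set (o ⊔ ℓ ⊔ e) where
    infixr 6 _+_
    field
      ⊥ : Obj
      ¡ : ∀ {A} → ⊥ ⇒ A
      ¡-unique : ∀ {A} (f : ⊥ ⇒ A) → f ≈ ¡
      _+_ : Obj → Obj → Obj
      inl : ∀ {A B} → A ⇒ A + B
      inr : ∀ {A B} → B ⇒ A + B
      isCoproduct : ∀ {A B} → IsCoproduct (inl {A} {B}) (inr {A} {B})

    [_,_] : ∀ {A B Z} → A ⇒ Z → B ⇒ Z → A + B ⇒ Z
    [ f , g ] = IsCoproduct.copair isCoproduct f g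

    record Summand (Y : Obj) : Set (o ⊔ ℓ ⊔ e) where
      field
        Y₁ Y₂ : Obj
        σ : Y₁ ⇒ Y
        σᶜ : Y₂ ⇒ Y
        isCoprod : IsCoproduct σ σᶜ

    inrSummand : ∀ {A B} → Summand (A + B)
    inrSummand {A} {B} = record
      { Y₁ = B ; Y₂ = A ; σ = inr ; σᶜ = inl
      ; isCoprod = record
        { copair = λ f g → [ g , f ]
        ; inject₁ = IsCoproduct.inject₂ isCoproduct
        ; inject₂ = IsCoproduct.inject₁ isCoproduct
        ; unique = λ p q → IsCoproduct.unique isCoproduct q p
        }
      }

  record Monad : Set (o ⊔ ℓ ⊔ e) where
    field
      T : Obj → Obj
      η : ∀ {A} → A ⇒ T A
      _* : ∀ {A B} → A ⇒ T B → T A ⇒ T B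
      η* : ∀ {A} → (η {A}) * ≈ id
      *-η : ∀ {A B} {f : A ⇒ T B} → f * ∘ η ≈ f
      *-assoc : ∀ {A B D} {f : A ⇒ T B} {g : B ⇒ T D} → (g * ∘ f) * ≈ g * ∘ f *
      *-resp-≈ : ∀ {A B} {f g : A ⇒ T B} → f ≈ g → f * ≈ g *

    Tmap : ∀ {A B} → A ⇒ B → T A ⇒ T B
    Tmap f = (η ∘ f) *

  record MonadMorphism (𝕋 𝕊 : Monad) : Set (o ⊔ ℓ ⊔ e) where
    module 𝕋 = Monad 𝕋
    module 𝕊 = Monad 𝕊
    field
      ρ : ∀ {X} → 𝕋.T X ⇒ 𝕊.T X
      natural : ∀ {X Y} {f : X ⇒ Y} → ρ ∘ 𝕋.Tmap f ≈ 𝕊.Tmap f ∘ ρ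
      ρ-η : ∀ {X} → ρ ∘ 𝕋.η {X} ≈ 𝕊.η
      ρ-* : ∀ {X Y} {f : X ⇒ 𝕋.T Y} → ρ ∘ (f 𝕋.*) ≈ (ρ ∘ f) 𝕊.* ∘ ρ

module _ {o ℓ e : Level} {C : Category o ℓ e} (FC : FiniteCoproducts C) where
  open Category C
  open FiniteCoproducts FC

  -- Guarded monads: a monad with a guardedness relation  f : X →_σ T Y.
  record GuardedMonad (g : Level) : Set (o ⊔ ℓ ⊔ e ⊔ lsuc g) where
    field
      monad : Monad C
    open Monad monad public
    field
      Guarded : ∀ {X Y} → Summand Y → X ⇒ T Y → Set g
      trv : ∀ {X Y Z} (f : X ⇒ T Y) →
            Guarded (inrSummand {Y} {Z}) (Tmap inl ∘ f)
      par : ∀ {X Y Z} {σ : Summand Z} {f : X ⇒ T Z} {g : Y ⇒ T Z} →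
            Guarded σ f → Guarded σ g → Guarded σ [ f , g ]
      cmp : ∀ {X Y Z V} {σ : Summand V} {f : X ⇒ T (Y + Z)} {g : Y ⇒ T V} {h : Z ⇒ T V} →
            Guarded inrSummand f → Guarded σ g → Guarded σ ([ g , h ] * ∘ f)

  module _ {g : Level} (𝕋 : GuardedMonad g) where
    open GuardedMonad 𝕋

    IterationOperator : Set (o ⊔ ℓ ⊔ g)
    IterationOperator = ∀ {X Y} (f : X ⇒ T (Y + X)) → Guarded inrSummand f → X ⇒ T Y

    IsGuardedPreIterative : IterationOperator → Set (o ⊔ ℓ ⊔ e ⊔ g)
    IsGuardedPreIterative dag =
      ∀ {X Y} (f : X ⇒ T (Y + X)) (p : Guarded inrSummand f) →
      dag f p ≈ [ η , dag f p ] * ∘ f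

  record GuardedRetraction {g₁ g₂ : Level} (𝕋 : GuardedMonad g₁) (𝕊 : GuardedMonad g₂)
         (ρ : MonadMorphism C (GuardedMonad.monad 𝕋) (GuardedMonad.monad 𝕊))
         : Set (o ⊔ ℓ ⊔ e ⊔ g₁ ⊔ g₂) where
    private
      module 𝕋 = GuardedMonad 𝕋
      module 𝕊 = GuardedMonad 𝕊
    open MonadMorphism ρ using () renaming (ρ to ρ′)
    field
      υ : ∀ {X} → 𝕊.T X ⇒ 𝕋.T X
      retract : ∀ {X} → ρ′ {X} ∘ υ ≈ id
      guard : ∀ {X Y} {σ : Summand Y} {f : X ⇒ 𝕊.T Y} →
              𝕊.Guarded σ f → 𝕋.Guarded σ (υ ∘ f)

  transferredIteration :
    ∀ {g₁ g₂} {𝕋 : GuardedMonad g₁} {𝕊 : GuardedMonad g₂}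
    {ρ : MonadMorphism C (GuardedMonad.monad 𝕋) (GuardedMonad.monad 𝕊)} →
    GuardedRetraction 𝕋 𝕊 ρ → IterationOperator 𝕋 → IterationOperator 𝕊
  transferredIteration {ρ = ρ} R dag f p =
    MonadMorphism.ρ ρ ∘ dag (GuardedRetraction.υ R ∘ f) (GuardedRetraction.guard R p)

module Submission where

open import Defs
open import Level using (Level)
open import Relation.Binary.Bundles using (Setoid)
import Relation.Binary.Reasoning.Setoid as SetoidReasoning

-- Apply ρ to the fixpoint equation of (υ ∘ f)†: ρ turns 𝕋-lifting into
-- 𝕊-lifting, carries [η, (υ ∘ f)†] to [η, f‡], and ρ ∘ υ ∘ f collapses to f.

module CategoryLemmas {o ℓ e : Level} (C : Category o ℓ e) where
  open Category C

  hom-setoid : Obj → Obj → Setoid ℓ e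
  hom-setoid A B = record { isEquivalence = equiv {A} {B} }

  module _ {A B : Obj} where
    open Setoid (hom-setoid A B) public
      using () renaming (refl to ≈-refl; sym to ≈-sym; trans to ≈-trans)

  ∘-resp-≈ˡ : ∀ {A B D} {f h : B ⇒ D} {g : A ⇒ B} → f ≈ h → f ∘ g ≈ h ∘ g
  ∘-resp-≈ˡ p = ∘-resp-≈ p ≈-refl

  ∘-resp-≈ʳ : ∀ {A B D} {f : B ⇒ D} {g i : A ⇒ B} → g ≈ i → f ∘ g ≈ f ∘ i
  ∘-resp-≈ʳ p = ∘-resp-≈ ≈-refl p

module CoproductLemmas {o ℓ e : Level} {C : Category o ℓ e} (FC : FiniteCoproducts C) where
  open Category C
  open CategoryLemmas C
  open FiniteCoproducts FC
  private
    module _ {A B : Obj} where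
      open IsCoproduct (isCoproduct {A} {B}) public using (inject₁; inject₂; unique)

  [,]-resp-≈ : ∀ {A B Z} {f f′ : A ⇒ Z} {g g′ : B ⇒ Z} →
               f ≈ f′ → g ≈ g′ → [ f , g ] ≈ [ f′ , g′ ]
  [,]-resp-≈ p q = unique (≈-trans inject₁ p) (≈-trans inject₂ q)

  ∘-[,] : ∀ {A B Z W} {f : A ⇒ Z} {g : B ⇒ Z} (h : Z ⇒ W) →
          h ∘ [ f , g ] ≈ [ h ∘ f , h ∘ g ]
  ∘-[,] h = unique (≈-trans assoc (∘-resp-≈ʳ inject₁))
                   (≈-trans assoc (∘-resp-≈ʳ inject₂))

module MonadMorphismLemmas {o ℓ e : Level} {C : Category o ℓ e} (FC : FiniteCoproducts C)
         {𝕋 𝕊 : Monad C} (ρM : MonadMorphism C 𝕋 𝕊) where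
  open Category C
  open CategoryLemmas C
  open FiniteCoproducts FC
  open CoproductLemmas FC
  open MonadMorphism ρM

  ρ-[η,] : ∀ {Y Z} (h : Z ⇒ 𝕋.T Y) → ρ ∘ [ 𝕋.η , h ] ≈ [ 𝕊.η , ρ ∘ h ]
  ρ-[η,] h = ≈-trans (∘-[,] ρ) ([,]-resp-≈ ρ-η ≈-refl)

module GuardedRetractionLemmas {o ℓ e g₁ g₂ : Level} {C : Category o ℓ e}
         (FC : FiniteCoproducts C) {𝕋 : GuardedMonad FC g₁} {𝕊 : GuardedMonad FC g₂}
         {ρM : MonadMorphism C (GuardedMonad.monad 𝕋) (GuardedMonad.monad 𝕊)}
         (R : GuardedRetraction FC 𝕋 𝕊 ρM) where
  open Category C
  open CategoryLemmas C
  open MonadMorphism ρM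
  open GuardedRetraction R

  ρ-*-υ : ∀ {X Y Z} (k : Y ⇒ 𝕋.T Z) (f : X ⇒ 𝕊.T Y) →
          ρ ∘ k 𝕋.* ∘ υ ∘ f ≈ (ρ ∘ k) 𝕊.* ∘ f
  ρ-*-υ k f = begin
    ρ ∘ k 𝕋.* ∘ υ ∘ f           ≈⟨ ≈-sym assoc ⟩
    (ρ ∘ k 𝕋.*) ∘ υ ∘ f         ≈⟨ ∘-resp-≈ˡ ρ-* ⟩
    ((ρ ∘ k) 𝕊.* ∘ ρ) ∘ υ ∘ f   ≈⟨ assoc ⟩
    (ρ ∘ k) 𝕊.* ∘ ρ ∘ υ ∘ f     ≈⟨ ∘-resp-≈ʳ (≈-sym assoc) ⟩
    (ρ ∘ k) 𝕊.* ∘ (ρ ∘ υ) ∘ f   ≈⟨ ∘-resp-≈ʳ (≈-trans (∘-resp-≈ˡ retract) identityˡ) ⟩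
    (ρ ∘ k) 𝕊.* ∘ f             ∎
    where open SetoidReasoning (hom-setoid _ _)

theorem5p4 : ∀ {o ℓ e g₁ g₂ : Level} {C : Category o ℓ e} (FC : FiniteCoproducts C)
               (𝕋 : GuardedMonad FC g₁) (𝕊 : GuardedMonad FC g₂)
               (ρ : MonadMorphism C (GuardedMonad.monad 𝕋) (GuardedMonad.monad 𝕊))
               (R : GuardedRetraction FC 𝕋 𝕊 ρ)
               (dag : IterationOperator FC 𝕋) →
               IsGuardedPreIterative FC 𝕋 dag →
               IsGuardedPreIterative FC 𝕊 (transferredIteration FC R dag)
theorem5p4 {C = C} FC 𝕋 𝕊 ρM R dag fix {X} {Y} f p = begin
    ρ ∘ f†                                ≈⟨ ∘-resp-≈ʳ (fix (υ ∘ f) (guard p)) ⟩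
    ρ ∘ [ 𝕋.η , f† ] 𝕋.* ∘ υ ∘ f          ≈⟨ ρ-*-υ [ 𝕋.η , f† ] f ⟩
    (ρ ∘ [ 𝕋.η , f† ]) 𝕊.* ∘ f            ≈⟨ ∘-resp-≈ˡ (𝕊.*-resp-≈ (ρ-[η,] f†)) ⟩
    [ 𝕊.η , ρ ∘ f† ] 𝕊.* ∘ f              ∎
  where
  open Category C
  open CategoryLemmas C
  open SetoidReasoning (hom-setoid _ _)
  open FiniteCoproducts FC
  module 𝕋 = GuardedMonad 𝕋
  module 𝕊 = GuardedMonad 𝕊
  open MonadMorphism ρM using (ρ)
  open MonadMorphismLemmas FC ρM
  open GuardedRetraction R using (υ; guard)
  open GuardedRetractionLemmas FC R
  f† : X ⇒ 𝕋.T Y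
  f† = dag (υ ∘ f) (guard p)
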